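{- Let $\mathcal{H}=(E,\mathscr{H})$ be a hereditary collection of rank $2$. Then $\mathcal{H}$ satisfies the point replacement property if and only if $\mathcal{H}$ is a matroid.
   Context: A hereditary collection is a pair $(E,\mathscr{H})$, $E$ a finite set, $\mathscr{H}\subseteq\mathcal{P}(E)$ nonempty and closed under subsets. A basis is an inclusion-maximal member of $\mathscr{H}$; the rank is the maximum cardinality of a basis. Point replacement: for every $p\in E$ with $\{p\}\in\mathscr{H}$ and every nonempty $J\in\mathscr{H}$ there is $x\in J$ with $(J\setminus\{x\})\cup\{p\}\in\mathscr{H}$. A matroid is a hereditary collection such that whenever $I,J\in\mathscr{H}$ with $|I|=|J|+1$ there is $i\in I\setminus J$ with $J\cup\{i\}\in\mathscr{H}$. -}

module Defs where

open import Data.Nat using (ℕ; _≤_; suc)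
open import Data.Fin using (Fin)
open import Data.Fin.Subset using (Subset; _⊆_; _⊂_; _∈_; _∉_; _∪_; _-_; ⁅_⁆; ∣_∣; Nonempty)
open import Data.Product using (Σ; ∃; ∃-syntax; _×_; _,_)
open import Relation.Nullary using (¬_)
open import Relation.Binary.PropositionalEquality using (_≡_)

record Hereditary (n : ℕ) : Set₁ where
  field
    ℋ         : Subset n → Set
    nonempty  : ∃[ I ] ℋ I
    hereditary : ∀ {I J} → J ⊆ I → ℋ I → ℋ J
open Hereditary public

IsBasis : ∀ {n} → Hereditary n → Subset n → Set
IsBasis H B = ℋ H B × (∀ J → B ⊂ J → ¬ ℋ H J)

HasRank : ∀ {n} → Hereditary n → ℕ → Set
HasRank H r = (∃[ B ] (IsBasis H B × ∣ B ∣ ≡ r)) × (∀ B → IsBasis H B → ∣ B ∣ ≤ r)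

PointReplacement : ∀ {n} → Hereditary n → Set
PointReplacement H =
  ∀ (p : Fin _) → ℋ H ⁅ p ⁆ → ∀ J → Nonempty J → ℋ H J →
    ∃[ x ] (x ∈ J × ℋ H ((J - x) ∪ ⁅ p ⁆))

IsMatroid : ∀ {n} → Hereditary n → Set
IsMatroid H =
  ∀ I J → ℋ H I → ℋ H J → ∣ I ∣ ≡ suc ∣ J ∣ →
    ∃[ i ] (i ∈ I × i ∉ J × ℋ H (J ∪ ⁅ i ⁆))

-- Every independent set of a rank-2 collection has at most two elements, so
-- both properties only ever speak about an independent pair {a, b} and a
-- point p. Augmenting {p} from the pair gives an independent pair {p, i}
-- with i ∈ {a, b}, which is exactly the replacement of the other element by
-- p; conversely, if p lies outside {a, b}, replacing some element x of the
-- pair by p makes the remaining element i augment {p}.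
module Submission where

open import Defs
open import Data.Nat using (ℕ; zero; suc; _≤_; _<_; z≤n; s≤s; _<?_)
open import Data.Nat.Properties using (≤-antisym; ≤-trans; ≤-pred; ≤-<-trans; <⇒≱; ≤⇒≯; ≮⇒≥; >⇒≢; <-trans; ≤-reflexive; module ≤-Reasoning)
open import Data.Nat.Induction using (<-wellFounded)
open import Data.Fin using (Fin; _≟_)
open import Data.Fin.Subset using (Subset; _⊆_; _⊃_; _∈_; _∉_; _∪_; _─_; _-_; ⁅_⁆; ∣_∣; ∁; Nonempty; inside; outside)
open import Data.Fin.Subset.Properties
open import Data.Vec using (_∷_; here; there)
open import Data.Product using (∃-syntax; _×_; _,_; proj₂)
open import Data.Sum using (inj₁; inj₂)
open import Data.Empty using (⊥-elim)
open import Function using (_∘_)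
open import Function.Bundles using (_⇔_; mk⇔)
open import Induction.WellFounded using (WellFounded; Acc; acc; module Subrelation)
open import Relation.Binary.Construct.On as On using ()
open import Relation.Nullary using (¬_; Dec; yes; no; contradiction)
open import Relation.Binary.PropositionalEquality using (_≡_; refl; sym; trans; cong; subst; _≢_; ≢-sym)

private
  variable
    n : ℕ

x∈p─q⇒x∉q : ∀ {x : Fin n} (p q : Subset n) → x ∈ p ─ q → x ∉ q
x∈p─q⇒x∉q (inside ∷ p) (outside ∷ q) here ()
x∈p─q⇒x∉q (_ ∷ p) (_ ∷ q) (there x∈p─q) (there x∈q) = x∈p─q⇒x∉q p q x∈p─q x∈q

x∈p-y⇒x≢y : ∀ {x y : Fin n} (p : Subset n) → x ∈ p - y → x ≢ y
x∈p-y⇒x≢y {y = y} p x∈p-y refl = x∈p─q⇒x∉q p ⁅ y ⁆ x∈p-y (x∈⁅x⁆ y)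

x∈p⇒⁅x⁆⊆p : ∀ {x : Fin n} {p : Subset n} → x ∈ p → ⁅ x ⁆ ⊆ p
x∈p⇒⁅x⁆⊆p {x = x} x∈p y∈⁅x⁆ = subst (_∈ _) (sym (x∈⁅y⁆⇒x≡y x y∈⁅x⁆)) x∈p

∪-least : ∀ {p q r : Subset n} → p ⊆ r → q ⊆ r → p ∪ q ⊆ r
∪-least {p = p} {q = q} p⊆r q⊆r x∈p∪q with x∈p∪q⁻ p q x∈p∪q
... | inj₁ x∈p = p⊆r x∈p
... | inj₂ x∈q = q⊆r x∈q

x∈p⇒0<∣p∣ : ∀ {x : Fin n} {p : Subset n} → x ∈ p → 0 < ∣ p ∣
x∈p⇒0<∣p∣ x∈p = ≤-<-trans z≤n (x∈p⇒∣p-x∣<∣p∣ x∈p)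

∣p∣≤1+k⇒∣p-x∣≤k : ∀ {k} {x : Fin n} {p : Subset n} → ∣ p ∣ ≤ suc k → x ∈ p → ∣ p - x ∣ ≤ k
∣p∣≤1+k⇒∣p-x∣≤k ∣p∣≤1+k x∈p = ≤-pred (≤-trans (x∈p⇒∣p-x∣<∣p∣ x∈p) ∣p∣≤1+k)

x≢y⇒2≤∣p∣ : ∀ {x y : Fin n} {p : Subset n} → x ∈ p → y ∈ p → x ≢ y → 2 ≤ ∣ p ∣
x≢y⇒2≤∣p∣ x∈p y∈p x≢y =
  ≤-trans (s≤s (x∈p⇒0<∣p∣ (x∈p∧x≢y⇒x∈p-y y∈p (≢-sym x≢y)))) (x∈p⇒∣p-x∣<∣p∣ x∈p)

∣p∣≤1⇒p⊆⁅x⁆ : ∀ {x : Fin n} {p : Subset n} → ∣ p ∣ ≤ 1 → x ∈ p → p ⊆ ⁅ x ⁆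
∣p∣≤1⇒p⊆⁅x⁆ {x = x} ∣p∣≤1 x∈p {y} y∈p with y ≟ x
... | yes refl = x∈⁅x⁆ x
... | no y≢x = contradiction ∣p∣≤1 (<⇒≱ (x≢y⇒2≤∣p∣ y∈p x∈p y≢x))

0<∣p∣⇒nonempty : ∀ (p : Subset n) → 0 < ∣ p ∣ → Nonempty p
0<∣p∣⇒nonempty {n} p 0<∣p∣ with nonempty? p
... | yes ne = ne
... | no empty = contradiction (trans (cong ∣_∣ (Empty-unique empty)) (∣⊥∣≡0 n)) (>⇒≢ 0<∣p∣)

¬nonempty[p-x]⇒p⊆⁅x⁆ : ∀ (p : Subset n) x → ¬ Nonempty (p - x) → p ⊆ ⁅ x ⁆
¬nonempty[p-x]⇒p⊆⁅x⁆ p x empty {y} y∈p with y ≟ x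
... | yes refl = x∈⁅x⁆ x
... | no y≢x = ⊥-elim (empty (y , x∈p∧x≢y⇒x∈p-y y∈p y≢x))

1<∣p∣⇒nonempty[p-x] : ∀ (p : Subset n) → 1 < ∣ p ∣ → ∀ x → Nonempty (p - x)
1<∣p∣⇒nonempty[p-x] p 1<∣p∣ x with nonempty? (p - x)
... | yes ne = ne
... | no empty = contradiction 1<∣p∣ (≤⇒≯ (begin
  ∣ p ∣     ≤⟨ p⊆q⇒∣p∣≤∣q∣ (¬nonempty[p-x]⇒p⊆⁅x⁆ p x empty) ⟩
  ∣ ⁅ x ⁆ ∣ ≡⟨ ∣⁅x⁆∣≡1 x ⟩
  1         ∎))
  where open ≤-Reasoning

⊃-wellFounded : WellFounded (_⊃_ {n})
⊃-wellFounded = Subrelation.wellFounded ⊃⇒∣∁∣> (On.wellFounded (∣_∣ ∘ ∁) <-wellFounded)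
  where
  ⊃⇒∣∁∣> : ∀ {p q : Subset n} → p ⊃ q → ∣ ∁ p ∣ < ∣ ∁ q ∣
  ⊃⇒∣∁∣> q⊂p = p⊂q⇒∣p∣<∣q∣ (p⊂q⇒∁p⊃∁q q⊂p)

module _ (H : Hereditary n) {r : ℕ} (rank : HasRank H r) where

  -- An independent set larger than r would be a basis, since by induction
  -- all its independent proper supersets are larger still.
  ¬independent-oversized : ∀ {I} → Acc _⊃_ I → ℋ H I → ¬ r < ∣ I ∣
  ¬independent-oversized {I} (acc rec) hI r<∣I∣ =
    <⇒≱ r<∣I∣ (proj₂ rank I (hI , λ J I⊂J hJ →
      ¬independent-oversized (rec I⊂J) hJ (<-trans r<∣I∣ (p⊂q⇒∣p∣<∣q∣ I⊂J))))

  independent⇒∣∣≤rank : ∀ {I} → ℋ H I → ∣ I ∣ ≤ r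
  independent⇒∣∣≤rank {I} hI = ≮⇒≥ (¬independent-oversized (⊃-wellFounded I) hI)

module _ (H : Hereditary n) where

  Augments : Subset n → Subset n → Set
  Augments I J = ∃[ i ] (i ∈ I × i ∉ J × ℋ H (J ∪ ⁅ i ⁆))

  augment-empty : ∀ {I J} → ℋ H I → 0 < ∣ I ∣ → ∣ J ∣ ≡ 0 → Augments I J
  augment-empty {I} {J} hI 0<∣I∣ ∣J∣≡0 with 0<∣p∣⇒nonempty I 0<∣I∣
  ... | i , i∈I = i , i∈I , J-empty , hereditary H (∪-least (⊥-elim ∘ J-empty) (x∈p⇒⁅x⁆⊆p i∈I)) hI
    where
    J-empty : ∀ {j} → j ∉ J
    J-empty j∈J = >⇒≢ (x∈p⇒0<∣p∣ j∈J) ∣J∣≡0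

  augment-singleton : PointReplacement H → ∀ {I J} j → ℋ H I → 1 < ∣ I ∣ → ℋ H ⁅ j ⁆ → J ⊆ ⁅ j ⁆ →
                      Augments I J
  augment-singleton replace {I} {J} j hI 1<∣I∣ h⁅j⁆ J⊆⁅j⁆ = exchange (j ∈? I)
    where
    augment-after-exchange : ∀ {x} → ℋ H ((I - x) ∪ ⁅ j ⁆) →
                             ∀ {i} → i ∈ I - x → i ≢ j → Augments I J
    augment-after-exchange h i∈I-x i≢j =
      _ , p─q⊆p I _ i∈I-x , i≢j ∘ x∈⁅y⁆⇒x≡y j ∘ J⊆⁅j⁆ ,
      hereditary H (∪-least (⊆-trans J⊆⁅j⁆ (q⊆p∪q _ _)) (⊆-trans (x∈p⇒⁅x⁆⊆p i∈I-x) (p⊆p∪q _))) h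
    exchange : Dec (j ∈ I) → Augments I J
    exchange (yes j∈I) with 1<∣p∣⇒nonempty[p-x] I 1<∣I∣ j
    ... | i , i∈I-j = augment-after-exchange (hereditary H (∪-least (p─q⊆p I _) (x∈p⇒⁅x⁆⊆p j∈I)) hI)
                                             i∈I-j (x∈p-y⇒x≢y I i∈I-j)
    exchange (no j∉I) with replace j h⁅j⁆ I (0<∣p∣⇒nonempty I (<-trans (s≤s z≤n) 1<∣I∣)) hI
    ... | x , _ , h with 1<∣p∣⇒nonempty[p-x] I 1<∣I∣ x
    ... | i , i∈I-x =
      augment-after-exchange h i∈I-x (λ i≡j → j∉I (subst (_∈ I) i≡j (p─q⊆p I _ i∈I-x)))

  replace-in-≤1 : ∀ {p x J} → ℋ H ⁅ p ⁆ → ∣ J ∣ ≤ 1 → x ∈ J → ℋ H ((J - x) ∪ ⁅ p ⁆)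
  replace-in-≤1 {p} {x} {J} h⁅p⁆ ∣J∣≤1 x∈J = hereditary H (∪-least J-x⊆⁅p⁆ ⊆-refl) h⁅p⁆
    where
    J-x⊆⁅p⁆ : J - x ⊆ ⁅ p ⁆
    J-x⊆⁅p⁆ y∈J-x = contradiction (x∈⁅y⁆⇒x≡y x (∣p∣≤1⇒p⊆⁅x⁆ ∣J∣≤1 x∈J (p─q⊆p J _ y∈J-x)))
                                  (x∈p-y⇒x≢y J y∈J-x)

  replace-in-pair : IsMatroid H → ∀ {p J} → ℋ H ⁅ p ⁆ → ℋ H J → ∣ J ∣ ≡ 2 →
                    ∃[ z ] (z ∈ J × ℋ H ((J - z) ∪ ⁅ p ⁆))
  replace-in-pair augment {p} {J} h⁅p⁆ hJ ∣J∣≡2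
    with augment J ⁅ p ⁆ hJ h⁅p⁆ (trans ∣J∣≡2 (cong suc (sym (∣⁅x⁆∣≡1 p))))
  ... | i , i∈J , _ , h⁅p⁆∪⁅i⁆ with 1<∣p∣⇒nonempty[p-x] J (≤-reflexive (sym ∣J∣≡2)) i
  ... | z , z∈J-i = z , z∈J , hereditary H (∪-least J-z⊆⁅p⁆∪⁅i⁆ (p⊆p∪q _)) h⁅p⁆∪⁅i⁆
    where
    z∈J = p─q⊆p J _ z∈J-i
    J-z⊆⁅p⁆∪⁅i⁆ : J - z ⊆ ⁅ p ⁆ ∪ ⁅ i ⁆
    J-z⊆⁅p⁆∪⁅i⁆ = ⊆-trans (∣p∣≤1⇒p⊆⁅x⁆ (∣p∣≤1+k⇒∣p-x∣≤k (≤-reflexive ∣J∣≡2) z∈J)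
                                         (x∈p∧x≢y⇒x∈p-y i∈J (≢-sym (x∈p-y⇒x≢y J z∈J-i))))
                          (q⊆p∪q ⁅ p ⁆ ⁅ i ⁆)

module _ (H : Hereditary n) (rank : HasRank H 2) where

  private
    ∣∣≤2 : ∀ {I} → ℋ H I → ∣ I ∣ ≤ 2
    ∣∣≤2 = independent⇒∣∣≤rank H rank

  matroid⇒pointReplacement : IsMatroid H → PointReplacement H
  matroid⇒pointReplacement augment p h⁅p⁆ J (x , x∈J) hJ with 1 <? ∣ J ∣
  ... | no ∣J∣≯1 = x , x∈J , replace-in-≤1 H h⁅p⁆ (≮⇒≥ ∣J∣≯1) x∈J
  ... | yes 1<∣J∣ = replace-in-pair H augment h⁅p⁆ hJ (≤-antisym (∣∣≤2 hJ) 1<∣J∣)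

  pointReplacement⇒matroid : PointReplacement H → IsMatroid H
  pointReplacement⇒matroid replace I J hI hJ ∣I∣≡1+∣J∣ with ∣ J ∣ in ∣J∣≡
  ... | zero = augment-empty H hI (subst (0 <_) (sym ∣I∣≡1+∣J∣) (s≤s z≤n)) ∣J∣≡
  ... | suc (suc _) =
    contradiction (∣∣≤2 hI) (<⇒≱ (subst (2 <_) (sym ∣I∣≡1+∣J∣) (s≤s (s≤s (s≤s z≤n)))))
  ... | suc zero with 0<∣p∣⇒nonempty J (subst (0 <_) (sym ∣J∣≡) (s≤s z≤n))
  ...   | j , j∈J = augment-singleton H replace j hI (subst (1 <_) (sym ∣I∣≡1+∣J∣) (s≤s (s≤s z≤n)))
                      (hereditary H (x∈p⇒⁅x⁆⊆p j∈J) hJ) (∣p∣≤1⇒p⊆⁅x⁆ (≤-reflexive ∣J∣≡) j∈J)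

proposition2p14 : ∀ (n : ℕ) (H : Hereditary n) → HasRank H 2 →
    (PointReplacement H ⇔ IsMatroid H)
proposition2p14 n H rank = mk⇔ (pointReplacement⇒matroid H rank) (matroid⇒pointReplacement H rank)
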